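{- Let $d\ge 1$. An octahedral system on $\mathbf{S}=\bigcup_{i=0}^d\mathbf{S}_i$ with at most $d^2$ edges contains no isolated edge.
   Context: $\mathbf{S}_0,\ldots,\mathbf{S}_d$ are disjoint sets ("colours") of $d+1$ points each. Consider hypergraphs on $\mathbf{S}$ whose edges each contain exactly one point of each $\mathbf{S}_i$. For a colour $i$, an $\widehat{i}$-transversal is a set of $d$ points containing exactly one point of each $\mathbf{S}_j$, $j\ne i$, and none of $\mathbf{S}_i$; an $\widehat{i}$-octahedron $\Omega$ is a pair of disjoint $\widehat{i}$-transversals (viewed as the union of their $2d$ points). The hypergraph is an octahedral system if for every colour $i$ and every $\widehat{i}$-octahedron $\Omega$, the parity of the number of edges $e$ with $e\cap\mathbf{S}_i=\{s\}$ and $e\setminus\{s\}\subseteq\Omega$ is the same for all $s\in\mathbf{S}_i$. An edge $e$ of the hypergraph is isolated if there is no other edge of the hypergraph that differs from $e$ in exactly one colour (i.e. $|e\setminus e'|=1$). -}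

module Defs where

open import Data.Nat using (ℕ; suc; _%_; _≤_; _*_)
open import Data.Fin using (Fin)
open import Data.Fin.Properties using (all?; _≟_)
open import Data.Vec using (Vec; lookup)
open import Data.List using (List; length; filter)
open import Data.List.Membership.Propositional using (_∈_)
open import Data.List.Relation.Unary.Unique.Propositional using (Unique)
open import Data.Product using (Σ; _×_; ∃-syntax)
open import Data.Sum using (_⊎_)
open import Relation.Nullary using (¬_; Dec)
open import Relation.Nullary.Decidable using (_⊎-dec_; _×-dec_; ¬?)
open import Relation.Binary.PropositionalEquality using (_≡_; _≢_)

-- Colours are Fin (suc d) (colours 0..d); each colour class S_i has d+1
-- points, indexed by Fin (suc d).  A point of S is thus a pair (colour, index).
-- An edge contains exactly one point of each colour, so it is determined by
-- the vector  colour i ↦ index of its point in S_i.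
Edge : ℕ → Set
Edge d = Vec (Fin (suc d)) (suc d)

record Hypergraph (d : ℕ) : Set where
  field
    edges  : List (Edge d)
    unique : Unique edges
open Hypergraph public

-- An î-transversal is represented by a vector of the same shape as an edge,
-- whose entry at colour i is ignored (it plays no role in any definition below).
DisjointHat : ∀ {d} → Fin (suc d) → Edge d → Edge d → Set
DisjointHat i t₁ t₂ = ∀ j → j ≢ i → lookup t₁ j ≢ lookup t₂ j

-- e ∩ S_i = {s}  and  e ∖ {s} ⊆ Ω = t₁ ∪ t₂
Supported : ∀ {d} → Fin (suc d) → Fin (suc d) → Edge d → Edge d → Edge d → Set
Supported i s t₁ t₂ e =
  (lookup e i ≡ s) ×
  (∀ j → (j ≡ i) ⊎ ((lookup e j ≡ lookup t₁ j) ⊎ (lookup e j ≡ lookup t₂ j)))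

supported? : ∀ {d} (i s : Fin (suc d)) (t₁ t₂ e : Edge d) → Dec (Supported i s t₁ t₂ e)
supported? i s t₁ t₂ e =
  (lookup e i ≟ s) ×-dec
  all? (λ j → (j ≟ i) ⊎-dec ((lookup e j ≟ lookup t₁ j) ⊎-dec (lookup e j ≟ lookup t₂ j)))

count : ∀ {d} → Hypergraph d → (i s : Fin (suc d)) → Edge d → Edge d → ℕ
count H i s t₁ t₂ = length (filter (supported? i s t₁ t₂) (edges H))

Octahedral : ∀ {d} → Hypergraph d → Set
Octahedral {d} H =
  ∀ (i : Fin (suc d)) (t₁ t₂ : Edge d) → DisjointHat i t₁ t₂ →
  ∀ (s s′ : Fin (suc d)) → count H i s t₁ t₂ % 2 ≡ count H i s′ t₁ t₂ % 2

DifferInOne : ∀ {d} → Edge d → Edge d → Set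
DifferInOne e e′ = ∃[ j ] (lookup e j ≢ lookup e′ j × (∀ k → k ≢ j → lookup e k ≡ lookup e′ k))

Isolated : ∀ {d} → Hypergraph d → Edge d → Set
Isolated H e = (e ∈ edges H) × (¬ (∃[ e′ ] ((e′ ∈ edges H) × DifferInOne e e′)))

module Submission where

-- Let e be an isolated edge and F the list of the other edges.  Call t avoiding
-- if t_j ≠ e_j for every colour j; then for every colour i, e ∪ t is an
-- î-octahedron containing e.  For each colour i and each avoiding t, count the
-- edges of F lying in e ∪ t, weighting an edge by d if its colour-i point is e_i
-- and by 1 otherwise; let Total F be the sum of these weighted counts.
--   * Lower bound: e itself is counted at e_i, so by the parity condition either
--     some edge of F passes through e_i, or all d other points of colour i are
--     covered by F; either way the weighted count is at least d, hence
--     Total F ≥ (d+1)·d·d^(d+1).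
--   * Upper bound: every f in F differs from e in at least two colours (f ≠ e
--     and e is isolated).  For fixed f and i, the avoiding t with f ⊆ e ∪ t form
--     a product set; counting coordinatewise gives d·(contribution of f) ≤
--     (d+1)·d^(d+1).

open import Defs
open import Data.Nat using (ℕ; zero; suc; _+_; _*_; _^_; _≤_; _<_; z≤n; _%_; NonZero)
open import Data.Nat.Base using (>-nonZero)
open import Data.Nat.Properties hiding (_≟_)
open import Data.Nat.Solver using (module +-*-Solver)
open import Data.Bool using (true; false; if_then_else_)
open import Data.Fin using (Fin; zero; suc; punchIn; punchOut)
open import Data.Fin.Properties using (all?; ¬∀⟶∃¬; _≟_; punchInᵢ≢i; punchIn-punchOut)
open import Data.Vec using (Vec; []; _∷_; lookup)
open import Data.Vec.Properties using (tabulate∘lookup; tabulate-cong)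
open import Data.Vec.Functional using (removeAt)
open import Data.List using (List; []; _∷_; _++_; length; filter)
open import Data.List.Properties using (length-++-sucʳ)
open import Data.List.Membership.Propositional using (_∈_)
open import Data.List.Membership.Propositional.Properties using (∈-∃++; ∈-++⁺ʳ)
open import Data.List.Relation.Binary.Subset.Propositional.Properties using (++⁺ʳ; xs⊆x∷xs)
open import Data.List.Relation.Unary.All as All using (All; []; _∷_)
import Data.List.Relation.Unary.AllPairs as AllPairs
open import Data.List.Relation.Unary.Any using (here)
open import Data.List.Relation.Unary.Unique.Propositional using (Unique)
open import Data.Product using (_×_; _,_; ∃-syntax)
open import Data.Sum using (_⊎_; inj₁; inj₂)
open import Data.Empty using (⊥-elim)
open import Relation.Nullary using (¬_; Dec; yes; no; does)
open import Relation.Nullary.Decidable using (¬?; _×-dec_; _⊎-dec_; dec-true; dec-false)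
open import Relation.Binary.PropositionalEquality
open import Function using (_∘_)
open import Algebra.Properties.CommutativeSemigroup +-commutativeSemigroup
  using () renaming (x∙yz≈y∙xz to +-swapˡ)
open import Algebra.Properties.CommutativeSemigroup *-commutativeSemigroup
  using () renaming (x∙yz≈y∙xz to *-swapˡ)
open import Algebra.Properties.Semiring.Sum +-*-semiring
  using (sum; sum-cong-≗; sum-remove; ∑-distrib-+; *-distribˡ-sum; *-distribʳ-sum)
open import Algebra.Properties.CommutativeMonoid.Sum *-1-commutativeMonoid
  using () renaming (sum to prod; sum-cong-≗ to prod-cong-≗; sum-remove to prod-remove;
                     ∑-distrib-+ to ∏-distrib-*)

𝟙 : ∀ {p} {P : Set p} → Dec P → ℕ
𝟙 P? = if does P? then 1 else 0

𝟙-yes : ∀ {p} {P : Set p} (P? : Dec P) → P → 𝟙 P? ≡ 1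
𝟙-yes (yes _) _ = refl
𝟙-yes (no ¬p) p = ⊥-elim (¬p p)

𝟙-no : ∀ {p} {P : Set p} (P? : Dec P) → ¬ P → 𝟙 P? ≡ 0
𝟙-no (yes p) ¬p = ⊥-elim (¬p p)
𝟙-no (no _) _ = refl

𝟙-mono : ∀ {p q} {P : Set p} {Q : Set q} (P? : Dec P) (Q? : Dec Q) → (P → Q) → 𝟙 P? ≤ 𝟙 Q?
𝟙-mono (yes _) (yes _) _ = ≤-refl
𝟙-mono (yes p) (no ¬q) P⇒Q = ⊥-elim (¬q (P⇒Q p))
𝟙-mono (no _) _ _ = z≤n

𝟙-*-≤ : ∀ {p} {P : Set p} (P? : Dec P) n → 𝟙 P? * n ≤ n
𝟙-*-≤ (yes _) n = ≤-reflexive (+-identityʳ n)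
𝟙-*-≤ (no _) n = z≤n

𝟙-× : ∀ {p q} {P : Set p} {Q : Set q} (P? : Dec P) (Q? : Dec Q) → 𝟙 (P? ×-dec Q?) ≡ 𝟙 P? * 𝟙 Q?
𝟙-× (yes _) (yes _) = refl
𝟙-× (yes _) (no _) = refl
𝟙-× (no _) _ = refl

∑-mono-≤ : ∀ {n} {g h : Fin n → ℕ} → (∀ x → g x ≤ h x) → sum g ≤ sum h
∑-mono-≤ {zero} _ = z≤n
∑-mono-≤ {suc n} g≤h = +-mono-≤ (g≤h zero) (∑-mono-≤ (g≤h ∘ suc))

∑-const : ∀ n c → sum {n} (λ _ → c) ≡ n * c
∑-const zero c = refl
∑-const (suc n) c = cong (c +_) (∑-const n c)

∑-term : ∀ {n} (g : Fin n → ℕ) y → g y ≤ sum g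
∑-term {suc n} g y = subst (g y ≤_) (sym (sum-remove {i = y} g)) (m≤m+n _ _)

∑-delta : ∀ {n} (y : Fin n) (h : Fin n → ℕ) → sum (λ s → 𝟙 (y ≟ s) * h s) ≡ h y
∑-delta {suc n} y h = begin
  sum term                                      ≡⟨ sum-remove {i = y} term ⟩
  term y + sum (removeAt term y)                ≡⟨ cong₂ _+_ (cong (_* h y) (𝟙-yes (y ≟ y) refl))
                                                             (sum-cong-≗ vanishes) ⟩
  1 * h y + sum {n} (λ _ → 0)                   ≡⟨ cong₂ _+_ (*-identityˡ (h y)) (∑-const n 0) ⟩
  h y + n * 0                                   ≡⟨ cong (h y +_) (*-zeroʳ n) ⟩
  h y + 0                                       ≡⟨ +-identityʳ (h y) ⟩
  h y                                           ∎
  where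
  open ≡-Reasoning
  term : Fin (suc n) → ℕ
  term s = 𝟙 (y ≟ s) * h s
  vanishes : ∀ k → term (punchIn y k) ≡ 0
  vanishes k = cong (_* h (punchIn y k)) (𝟙-no (y ≟ punchIn y k) (punchInᵢ≢i y k ∘ sym))

∑-point : ∀ {n} (y : Fin n) → sum (λ s → 𝟙 (y ≟ s)) ≡ 1
∑-point y = trans (sum-cong-≗ (λ s → sym (*-identityʳ (𝟙 (y ≟ s))))) (∑-delta y (λ _ → 1))

∑-≢ : ∀ {n} (y : Fin (suc n)) → sum (λ s → 𝟙 (¬? (y ≟ s))) ≡ n
∑-≢ {n} y = begin
  sum term                             ≡⟨ sum-remove {i = y} term ⟩
  term y + sum (removeAt term y)       ≡⟨ cong₂ _+_ (𝟙-no (¬? (y ≟ y)) (λ y≢y → y≢y refl))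
                                                    (sum-cong-≗ counted) ⟩
  sum {n} (λ _ → 1)                    ≡⟨ ∑-const n 1 ⟩
  n * 1                                ≡⟨ *-identityʳ n ⟩
  n                                    ∎
  where
  open ≡-Reasoning
  term : Fin (suc n) → ℕ
  term s = 𝟙 (¬? (y ≟ s))
  counted : ∀ k → term (punchIn y k) ≡ 1
  counted k = 𝟙-yes (¬? (y ≟ punchIn y k)) (punchInᵢ≢i y k ∘ sym)

∏-mono-≤ : ∀ {n} {g h : Fin n → ℕ} → (∀ x → g x ≤ h x) → prod g ≤ prod h
∏-mono-≤ {zero} _ = ≤-refl
∏-mono-≤ {suc n} g≤h = *-mono-≤ (g≤h zero) (∏-mono-≤ (g≤h ∘ suc))

∏-const : ∀ n c → prod {n} (λ _ → c) ≡ c ^ n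
∏-const zero c = refl
∏-const (suc n) c = cong (c *_) (∏-const n c)

∏-bound : ∀ {n c} (g : Fin n → ℕ) → (∀ j → g j ≤ c) → prod g ≤ c ^ n
∏-bound {n} {c} g g≤c = ≤-trans (∏-mono-≤ g≤c) (≤-reflexive (∏-const n c))

∏-bound-one : ∀ {n c} (g : Fin n → ℕ) y → (∀ j → g j ≤ c) → g y ≤ 1 → c * prod g ≤ c ^ n
∏-bound-one {suc n} {c} g y g≤c gy≤1 = begin
  c * prod g                          ≡⟨ cong (c *_) (prod-remove {i = y} g) ⟩
  c * (g y * prod (removeAt g y))     ≤⟨ *-monoʳ-≤ c (*-mono-≤ gy≤1 (∏-bound _ (g≤c ∘ punchIn y))) ⟩
  c * (1 * c ^ n)                     ≡⟨ cong (c *_) (*-identityˡ (c ^ n)) ⟩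
  c ^ suc n                           ∎
  where open ≤-Reasoning

∏-bound-two : ∀ {n c} (g : Fin n → ℕ) {y z} → y ≢ z → (∀ j → g j ≤ c) → g y ≤ 1 → g z ≤ 1 →
              c * (c * prod g) ≤ c ^ n
∏-bound-two {suc n} {c} g {y} {z} y≢z g≤c gy≤1 gz≤1 = begin
  c * (c * prod g)                    ≡⟨ cong (λ p → c * (c * p)) (prod-remove {i = y} g) ⟩
  c * (c * (g y * prod rest))         ≡⟨ cong (c *_) (*-swapˡ c (g y) (prod rest)) ⟩
  c * (g y * (c * prod rest))         ≤⟨ *-monoʳ-≤ c (*-mono-≤ gy≤1 rest-bound) ⟩
  c * (1 * c ^ n)                     ≡⟨ cong (c *_) (*-identityˡ (c ^ n)) ⟩
  c ^ suc n                           ∎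
  where
  open ≤-Reasoning
  rest : Fin n → ℕ
  rest = removeAt g y
  rest-bound : c * prod rest ≤ c ^ n
  rest-bound = ∏-bound-one rest (punchOut y≢z) (g≤c ∘ punchIn y)
                 (subst (_≤ 1) (sym (cong g (punchIn-punchOut y≢z))) gz≤1)

∏-zero : ∀ {n} (g : Fin n → ℕ) y → g y ≡ 0 → prod g ≡ 0
∏-zero {suc n} g y gy≡0 = trans (prod-remove {i = y} g) (cong (_* prod (removeAt g y)) gy≡0)

𝟙-all : ∀ {n p} {P : Fin n → Set p} (P? : ∀ j → Dec (P j)) → 𝟙 (all? P?) ≡ prod (λ j → 𝟙 (P? j))
𝟙-all {n} {P = P} P? = by-decision (all? P?)
  where
  open ≡-Reasoning
  by-decision : (all-P? : Dec (∀ j → P j)) → 𝟙 all-P? ≡ prod (λ j → 𝟙 (P? j))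
  by-decision (yes all-P) = sym (begin
    prod (λ j → 𝟙 (P? j))   ≡⟨ prod-cong-≗ (λ j → 𝟙-yes (P? j) (all-P j)) ⟩
    prod {n} (λ _ → 1)      ≡⟨ ∏-const n 1 ⟩
    1 ^ n                   ≡⟨ ^-zeroˡ n ⟩
    1                       ∎)
  by-decision (no ¬all-P) =
    let j , ¬Pj = ¬∀⟶∃¬ n P P? ¬all-P
    in sym (∏-zero _ j (𝟙-no (P? j) ¬Pj))

ΣVec : ∀ {n k} → (Vec (Fin k) n → ℕ) → ℕ
ΣVec {zero} G = G []
ΣVec {suc n} G = sum (λ a → ΣVec (λ v → G (a ∷ v)))

ΣVec-cong : ∀ {n k} {G G′ : Vec (Fin k) n → ℕ} → (∀ v → G v ≡ G′ v) → ΣVec G ≡ ΣVec G′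
ΣVec-cong {zero} G≡G′ = G≡G′ []
ΣVec-cong {suc n} G≡G′ = sum-cong-≗ (λ a → ΣVec-cong (λ v → G≡G′ (a ∷ v)))

ΣVec-mono-≤ : ∀ {n k} {G G′ : Vec (Fin k) n → ℕ} → (∀ v → G v ≤ G′ v) → ΣVec G ≤ ΣVec G′
ΣVec-mono-≤ {zero} G≤G′ = G≤G′ []
ΣVec-mono-≤ {suc n} G≤G′ = ∑-mono-≤ (λ a → ΣVec-mono-≤ (λ v → G≤G′ (a ∷ v)))

ΣVec-+ : ∀ {n k} (G G′ : Vec (Fin k) n → ℕ) → ΣVec (λ v → G v + G′ v) ≡ ΣVec G + ΣVec G′
ΣVec-+ {zero} G G′ = refl
ΣVec-+ {suc n} {k} G G′ = trans (sum-cong-≗ (λ a → ΣVec-+ (G ∘ (a ∷_)) (G′ ∘ (a ∷_)))) (∑-distrib-+ {k} _ _)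

ΣVec-*ˡ : ∀ {n k} c (G : Vec (Fin k) n → ℕ) → ΣVec (λ v → c * G v) ≡ c * ΣVec G
ΣVec-*ˡ {zero} c G = refl
ΣVec-*ˡ {suc n} {k} c G = trans (sum-cong-≗ (λ a → ΣVec-*ˡ c (G ∘ (a ∷_)))) (sym (*-distribˡ-sum {k} c _))

ΣVec-prod : ∀ {n k} (g : Fin n → Fin k → ℕ) →
            ΣVec (λ v → prod (λ j → g j (lookup v j))) ≡ prod (λ j → sum (g j))
ΣVec-prod {zero} g = refl
ΣVec-prod {suc n} {k} g = begin
  sum (λ a → ΣVec (λ v → g zero a * prod (λ j → g (suc j) (lookup v j))))
    ≡⟨ sum-cong-≗ (λ a → ΣVec-*ˡ {n} (g zero a) (λ v → prod (λ j → g (suc j) (lookup v j)))) ⟩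
  sum (λ a → g zero a * ΣVec (λ v → prod (λ j → g (suc j) (lookup v j))))
    ≡⟨ sum-cong-≗ (λ a → cong (g zero a *_) (ΣVec-prod (g ∘ suc))) ⟩
  sum (λ a → g zero a * prod (λ j → sum (g (suc j))))
    ≡⟨ sym (*-distribʳ-sum {k} _ (g zero)) ⟩
  sum (g zero) * prod (λ j → sum (g (suc j)))
    ∎
  where open ≡-Reasoning

vec-ext : ∀ {a} {A : Set a} {n} {u v : Vec A n} → (∀ j → lookup u j ≡ lookup v j) → u ≡ v
vec-ext {u = u} {v} u≗v = trans (sym (tabulate∘lookup u)) (trans (tabulate-cong u≗v) (tabulate∘lookup v))

length-filter-∷ : ∀ {a p} {A : Set a} {P : A → Set p} (P? : ∀ x → Dec (P x)) x xs →
                  length (filter P? (x ∷ xs)) ≡ 𝟙 (P? x) + length (filter P? xs)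
length-filter-∷ P? x xs with does (P? x)
... | true = refl
... | false = refl

length-filter-insert : ∀ {a p} {A : Set a} {P : A → Set p} (P? : ∀ x → Dec (P x)) x ys zs →
                       length (filter P? (ys ++ x ∷ zs)) ≡ 𝟙 (P? x) + length (filter P? (ys ++ zs))
length-filter-insert P? x [] zs = length-filter-∷ P? x zs
length-filter-insert P? x (y ∷ ys) zs = begin
  length (filter P? (y ∷ ys ++ x ∷ zs))               ≡⟨ length-filter-∷ P? y (ys ++ x ∷ zs) ⟩
  𝟙 (P? y) + length (filter P? (ys ++ x ∷ zs))        ≡⟨ cong (𝟙 (P? y) +_) (length-filter-insert P? x ys zs) ⟩
  𝟙 (P? y) + (𝟙 (P? x) + length (filter P? (ys ++ zs))) ≡⟨ +-swapˡ (𝟙 (P? y)) (𝟙 (P? x)) _ ⟩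
  𝟙 (P? x) + (𝟙 (P? y) + length (filter P? (ys ++ zs))) ≡⟨ cong (𝟙 (P? x) +_) (sym (length-filter-∷ P? y (ys ++ zs))) ⟩
  𝟙 (P? x) + length (filter P? (y ∷ ys ++ zs))        ∎
  where open ≡-Reasoning

others-distinct : ∀ {a} {A : Set a} {x : A} ys zs → Unique (ys ++ x ∷ zs) → All (_≢ x) (ys ++ zs)
others-distinct [] zs (x≢zs AllPairs.∷ _) = All.map (λ x≢z z≡x → x≢z (sym z≡x)) x≢zs
others-distinct (y ∷ ys) zs (y≢rest AllPairs.∷ rest) =
  All.lookup y≢rest (∈-++⁺ʳ ys (here refl)) ∷ others-distinct ys zs rest

DifferInTwo : ∀ {d} → Edge d → Edge d → Set
DifferInTwo e f = ∃[ j ] ∃[ k ] (j ≢ k × lookup e j ≢ lookup f j × lookup e k ≢ lookup f k)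

differ-in-two : ∀ {d} {e f : Edge d} → f ≢ e → ¬ DifferInOne e f → DifferInTwo e f
differ-in-two {d} {e} {f} f≢e ¬one =
  let j , ej≢fj = ¬∀⟶∃¬ (suc d) _ (λ j → lookup e j ≟ lookup f j) (f≢e ∘ sym ∘ vec-ext)
      k , k-differs = ¬∀⟶∃¬ (suc d) _ (λ k → (k ≟ j) ⊎-dec (lookup e k ≟ lookup f k))
                        (λ agree → ¬one (j , ej≢fj , λ k k≢j → only-j (agree k) k≢j))
  in j , k , (λ j≡k → k-differs (inj₁ (sym j≡k))) , ej≢fj , (λ ek≡fk → k-differs (inj₂ ek≡fk))
  where
  only-j : ∀ {k j} → (k ≡ j) ⊎ (lookup e k ≡ lookup f k) → k ≢ j → lookup e k ≡ lookup f k
  only-j (inj₁ k≡j) k≢j = ⊥-elim (k≢j k≡j)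
  only-j (inj₂ ek≡fk) _ = ek≡fk

module Counting {d : ℕ} (e : Edge d) where

  avoid? : (j a : Fin (suc d)) → Dec (lookup e j ≢ a)
  avoid? j a = ¬? (lookup e j ≟ a)

  avoids? : (t : Edge d) → Dec (∀ j → lookup e j ≢ lookup t j)
  avoids? t = all? (λ j → avoid? j (lookup t j))

  weight : Fin (suc d) → Fin (suc d) → ℕ
  weight i s = if does (lookup e i ≟ s) then d else 1

  weight-own : ∀ {i s} → lookup e i ≡ s → weight i s ≡ d
  weight-own {i} {s} eᵢ≡s = cong (if_then d else 1) (dec-true (lookup e i ≟ s) eᵢ≡s)

  weight-other : ∀ {i s} → lookup e i ≢ s → weight i s ≡ 1
  weight-other {i} {s} eᵢ≢s = cong (if_then d else 1) (dec-false (lookup e i ≟ s) eᵢ≢s)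

  Count : Set
  Count = Fin (suc d) → Edge d → Fin (suc d) → ℕ

  weighted : Count → Fin (suc d) → Edge d → ℕ
  weighted c i t = sum (λ s → weight i s * c i t s)

  colourTotal : Count → Fin (suc d) → ℕ
  colourTotal c i = ΣVec (λ t → 𝟙 (avoids? t) * weighted c i t)

  weightedTotal : Count → ℕ
  weightedTotal c = sum (colourTotal c)

  weightedTotal-cong : ∀ {c c′ : Count} → (∀ i t s → c i t s ≡ c′ i t s) → weightedTotal c ≡ weightedTotal c′
  weightedTotal-cong c≡c′ = sum-cong-≗ (λ i → ΣVec-cong (λ t →
    cong (𝟙 (avoids? t) *_) (sum-cong-≗ (λ s → cong (weight i s *_) (c≡c′ i t s)))))

  weightedTotal-+ : ∀ (c c′ : Count) → weightedTotal (λ i t s → c i t s + c′ i t s) ≡ weightedTotal c + weightedTotal c′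
  weightedTotal-+ c c′ = trans (sum-cong-≗ per-colour) (∑-distrib-+ (colourTotal c) (colourTotal c′))
    where
    per-point : ∀ i t → weighted (λ i t s → c i t s + c′ i t s) i t ≡ weighted c i t + weighted c′ i t
    per-point i t = trans (sum-cong-≗ (λ s → *-distribˡ-+ (weight i s) (c i t s) (c′ i t s)))
                          (∑-distrib-+ (λ s → weight i s * c i t s) (λ s → weight i s * c′ i t s))
    per-colour : ∀ i → colourTotal (λ i t s → c i t s + c′ i t s) i ≡ colourTotal c i + colourTotal c′ i
    per-colour i = trans
      (ΣVec-cong (λ t → trans (cong (𝟙 (avoids? t) *_) (per-point i t))
                              (*-distribˡ-+ (𝟙 (avoids? t)) (weighted c i t) (weighted c′ i t))))
      (ΣVec-+ (λ t → 𝟙 (avoids? t) * weighted c i t) (λ t → 𝟙 (avoids? t) * weighted c′ i t))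

  weightedTotal-zero : weightedTotal (λ _ _ _ → 0) ≡ 0
  weightedTotal-zero = sym (+-cancelˡ-≡ W _ _ (trans (+-identityʳ W) (weightedTotal-+ zero-count zero-count)))
    where
    zero-count : Count
    zero-count _ _ _ = 0
    W : ℕ
    W = weightedTotal zero-count

  inOctahedron : List (Edge d) → Count
  inOctahedron F i t s = length (filter (supported? i s e t) F)

  Total : List (Edge d) → ℕ
  Total F = weightedTotal (inOctahedron F)

  supports : Edge d → Count
  supports f i t s = 𝟙 (supported? i s e t f)

  contribution : Edge d → ℕ
  contribution f = weightedTotal (supports f)

  Total-[] : Total [] ≡ 0
  Total-[] = weightedTotal-zero

  Total-∷ : ∀ f F → Total (f ∷ F) ≡ contribution f + Total F
  Total-∷ f F = trans (weightedTotal-cong (λ i t s → length-filter-∷ (supported? i s e t) f F))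
                      (weightedTotal-+ (supports f) (inOctahedron F))

  fits? : (f : Edge d) (i j a : Fin (suc d)) →
       Dec ((j ≡ i) ⊎ ((lookup f j ≡ lookup e j) ⊎ (lookup f j ≡ a)))
  fits? f i j a = (j ≟ i) ⊎-dec ((lookup f j ≟ lookup e j) ⊎-dec (lookup f j ≟ a))

  choice : (f : Edge d) (i j a : Fin (suc d)) → ℕ
  choice f i j a = 𝟙 (avoid? j a) * 𝟙 (fits? f i j a)

  choices : (f : Edge d) (i j : Fin (suc d)) → ℕ
  choices f i j = sum (choice f i j)

  colour-share : ∀ f i → colourTotal (supports f) i ≡ weight i (lookup f i) * prod (choices f i)
  colour-share f i = begin
    ΣVec (λ t → A t * weighted (supports f) i t)
      ≡⟨ ΣVec-cong (λ t → cong (A t *_) (point-forced t)) ⟩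
    ΣVec (λ t → A t * (w * C t))
      ≡⟨ ΣVec-cong (λ t → *-swapˡ (A t) w (C t)) ⟩
    ΣVec (λ t → w * (A t * C t))
      ≡⟨ ΣVec-*ˡ w (λ t → A t * C t) ⟩
    w * ΣVec (λ t → A t * C t)
      ≡⟨ cong (w *_) (ΣVec-cong factorise) ⟩
    w * ΣVec (λ t → prod (λ j → choice f i j (lookup t j)))
      ≡⟨ cong (w *_) (ΣVec-prod (choice f i)) ⟩
    w * prod (choices f i)
      ∎
    where
    open ≡-Reasoning
    w : ℕ
    w = weight i (lookup f i)
    A C : Edge d → ℕ
    A t = 𝟙 (avoids? t)
    C t = 𝟙 (all? (λ j → fits? f i j (lookup t j)))
    -- only s = f_i can be f's colour-i point
    point-forced : ∀ t → weighted (supports f) i t ≡ w * C t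
    point-forced t = trans
      (sum-cong-≗ (λ s → trans (cong (weight i s *_) (𝟙-× (lookup f i ≟ s) (all? (λ j → fits? f i j (lookup t j)))))
                               (*-swapˡ (weight i s) (𝟙 (lookup f i ≟ s)) (C t))))
      (∑-delta (lookup f i) (λ s → weight i s * C t))
    factorise : ∀ t → A t * C t ≡ prod (λ j → choice f i j (lookup t j))
    factorise t = trans (cong₂ _*_ (𝟙-all (λ j → avoid? j (lookup t j))) (𝟙-all (λ j → fits? f i j (lookup t j))))
                        (sym (∏-distrib-* (λ j → 𝟙 (avoid? j (lookup t j))) (λ j → 𝟙 (fits? f i j (lookup t j)))))

  -- At most d values avoid e_j.
  choices≤d : ∀ f i j → choices f i j ≤ d
  choices≤d f i j = begin
    sum (choice f i j)                    ≤⟨ ∑-mono-≤ (λ a → subst (_≤ 𝟙 (avoid? j a)) (*-comm (𝟙 (fits? f i j a)) (𝟙 (avoid? j a)))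
                                                                  (𝟙-*-≤ (fits? f i j a) (𝟙 (avoid? j a)))) ⟩
    sum (λ a → 𝟙 (¬? (lookup e j ≟ a)))   ≡⟨ ∑-≢ (lookup e j) ⟩
    d                                     ∎
    where open ≤-Reasoning

  -- Where f differs from e (away from colour i), t_j is forced to be f_j.
  choices≤1 : ∀ f i j → j ≢ i → lookup e j ≢ lookup f j → choices f i j ≤ 1
  choices≤1 f i j j≢i ej≢fj = begin
    sum (choice f i j)                    ≤⟨ ∑-mono-≤ (λ a → ≤-trans (𝟙-*-≤ (avoid? j a) (𝟙 (fits? f i j a)))
                                                                     (𝟙-mono (fits? f i j a) (lookup f j ≟ a) forced)) ⟩
    sum (λ a → 𝟙 (lookup f j ≟ a))        ≡⟨ ∑-point (lookup f j) ⟩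
    1                                     ∎
    where
    open ≤-Reasoning
    forced : ∀ {a} → (j ≡ i) ⊎ ((lookup f j ≡ lookup e j) ⊎ (lookup f j ≡ a)) → lookup f j ≡ a
    forced (inj₁ j≡i) = ⊥-elim (j≢i j≡i)
    forced (inj₂ (inj₁ fj≡ej)) = ⊥-elim (ej≢fj (sym fj≡ej))
    forced (inj₂ (inj₂ fj≡a)) = fj≡a

  colour-bound : ∀ {f} i → DifferInTwo e f → d * (weight i (lookup f i) * prod (choices f i)) ≤ d ^ suc d
  colour-bound {f} i (j , k , j≢k , ej≢fj , ek≢fk) = by-colour-i (lookup e i ≟ lookup f i)
    where
    bound-for : ℕ → Set
    bound-for w = d * (w * prod (choices f i)) ≤ d ^ suc d
    by-colour-i : Dec (lookup e i ≡ lookup f i) → bound-for (weight i (lookup f i))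
    -- f passes through e_i: weight d, and both j and k differ from i
    by-colour-i (yes eᵢ≡fᵢ) = subst bound-for (sym (weight-own eᵢ≡fᵢ))
      (∏-bound-two (choices f i) j≢k (choices≤d f i) (choices≤1 f i j (away ej≢fj) ej≢fj)
                                                   (choices≤1 f i k (away ek≢fk) ek≢fk))
      where
      away : ∀ {m} → lookup e m ≢ lookup f m → m ≢ i
      away em≢fm refl = em≢fm eᵢ≡fᵢ
    -- f avoids e_i: weight 1, and one of j, k differs from i
    by-colour-i (no eᵢ≢fᵢ) = subst bound-for (sym (weight-other eᵢ≢fᵢ))
      (subst (_≤ d ^ suc d) (cong (d *_) (sym (*-identityˡ _))) (one-factor (j ≟ i)))
      where
      one-factor : Dec (j ≡ i) → d * prod (choices f i) ≤ d ^ suc d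
      one-factor (no j≢i) = ∏-bound-one (choices f i) j (choices≤d f i) (choices≤1 f i j j≢i ej≢fj)
      one-factor (yes refl) = ∏-bound-one (choices f i) k (choices≤d f i) (choices≤1 f i k (j≢k ∘ sym) ek≢fk)

  contribution-bound : ∀ {f} → DifferInTwo e f → d * contribution f ≤ suc d * d ^ suc d
  contribution-bound {f} two = begin
    d * contribution f                              ≡⟨ *-distribˡ-sum d (colourTotal (supports f)) ⟩
    sum (λ i → d * colourTotal (supports f) i)      ≤⟨ ∑-mono-≤ (λ i → subst (λ x → d * x ≤ d ^ suc d)
                                                                         (sym (colour-share f i)) (colour-bound {f} i two)) ⟩
    sum {suc d} (λ _ → d ^ suc d)                   ≡⟨ ∑-const (suc d) (d ^ suc d) ⟩
    suc d * d ^ suc d                               ∎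
    where open ≤-Reasoning

  upper : ∀ F → All (DifferInTwo e) F → d * Total F ≤ length F * (suc d * d ^ suc d)
  upper [] [] = ≤-reflexive (trans (cong (d *_) Total-[]) (*-zeroʳ d))
  upper (f ∷ F) (two ∷ twos) = begin
    d * Total (f ∷ F)                   ≡⟨ cong (d *_) (Total-∷ f F) ⟩
    d * (contribution f + Total F)      ≡⟨ *-distribˡ-+ d (contribution f) (Total F) ⟩
    d * contribution f + d * Total F    ≤⟨ +-mono-≤ (contribution-bound {f} two) (upper F twos) ⟩
    suc (length F) * (suc d * d ^ suc d) ∎
    where open ≤-Reasoning

  self-supported : ∀ i s t → 𝟙 (supported? i s e t e) ≡ 𝟙 (lookup e i ≟ s)
  self-supported i s t = begin
    𝟙 (supported? i s e t e)                     ≡⟨ 𝟙-× (lookup e i ≟ s) e-fits ⟩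
    𝟙 (lookup e i ≟ s) * 𝟙 e-fits                ≡⟨ cong (𝟙 (lookup e i ≟ s) *_) (𝟙-yes e-fits (λ _ → inj₂ (inj₁ refl))) ⟩
    𝟙 (lookup e i ≟ s) * 1                       ≡⟨ *-identityʳ (𝟙 (lookup e i ≟ s)) ⟩
    𝟙 (lookup e i ≟ s)                           ∎
    where
    open ≡-Reasoning
    e-fits : Dec (∀ j → (j ≡ i) ⊎ ((lookup e j ≡ lookup e j) ⊎ (lookup e j ≡ lookup t j)))
    e-fits = all? (λ j → fits? e i j (lookup t j))

  avoiding-count : ΣVec (λ t → 𝟙 (avoids? t)) ≡ d ^ suc d
  avoiding-count = begin
    ΣVec (λ t → 𝟙 (avoids? t))                               ≡⟨ ΣVec-cong (λ t → 𝟙-all (λ j → avoid? j (lookup t j))) ⟩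
    ΣVec (λ t → prod (λ j → 𝟙 (avoid? j (lookup t j))))      ≡⟨ ΣVec-prod (λ j a → 𝟙 (avoid? j a)) ⟩
    prod (λ j → sum (λ a → 𝟙 (avoid? j a)))                  ≡⟨ prod-cong-≗ (λ j → ∑-≢ (lookup e j)) ⟩
    prod {suc d} (λ _ → d)                                   ≡⟨ ∏-const (suc d) d ⟩
    d ^ suc d                                                ∎
    where open ≡-Reasoning

  -- Parity step: let c s = [s = e_i] + k s count the edges through each colour-i
  -- point s of an octahedron containing e.
  parity-lower : ∀ i (c k : Fin (suc d) → ℕ) → (∀ s → c s ≡ 𝟙 (lookup e i ≟ s) + k s) →
                 (∀ s → c s % 2 ≡ c (lookup e i) % 2) → d ≤ sum (λ s → weight i s * k s)
  parity-lower i c k c≡ same-parity with k (lookup e i) in k-at-eᵢ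
  ... | suc m = begin
    d                                    ≤⟨ m≤m*n d (suc m) ⟩
    d * suc m                            ≡⟨ cong₂ _*_ (sym (weight-own refl)) (sym k-at-eᵢ) ⟩
    weight i eᵢ * k eᵢ                   ≤⟨ ∑-term (λ s → weight i s * k s) eᵢ ⟩
    sum (λ s → weight i s * k s)         ∎
    where
    open ≤-Reasoning
    eᵢ : Fin (suc d)
    eᵢ = lookup e i
  ... | zero = begin
    d                                    ≡⟨ sym (∑-≢ (lookup e i)) ⟩
    sum (λ s → 𝟙 (¬? (lookup e i ≟ s)))  ≤⟨ ∑-mono-≤ covered ⟩
    sum (λ s → weight i s * k s)         ∎
    where
    open ≤-Reasoning
    -- e is the only edge through e_i, so c (e_i) = 1 is odd, and so is every c s.
    odd : ∀ s → c s % 2 ≡ 1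
    odd s = trans (same-parity s) (cong (_% 2) (trans (c≡ (lookup e i))
                    (cong₂ _+_ (𝟙-yes (lookup e i ≟ lookup e i) refl) k-at-eᵢ)))
    covered : ∀ s → 𝟙 (¬? (lookup e i ≟ s)) ≤ weight i s * k s
    covered s = by-point (lookup e i ≟ s)
      where
      by-point : (eᵢ≟s : Dec (lookup e i ≡ s)) → 𝟙 (¬? eᵢ≟s) ≤ weight i s * k s
      by-point (yes _) = z≤n
      by-point (no eᵢ≢s) = subst (1 ≤_) (sym (trans (cong (_* k s) (weight-other eᵢ≢s)) (*-identityˡ (k s))))
                      (n≢0⇒n>0 k≢0)
        where
        k≢0 : k s ≢ 0
        k≢0 ks≡0 = 0≢1+n (trans (cong (_% 2) (sym c≡0)) (odd s))
          where
          c≡0 : c s ≡ 0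
          c≡0 = trans (c≡ s) (cong₂ _+_ (𝟙-no (lookup e i ≟ s) eᵢ≢s) ks≡0)

  lower : ∀ (H : Hypergraph d) F → Octahedral H →
          (∀ i t s → count H i s e t ≡ 𝟙 (lookup e i ≟ s) + inOctahedron F i t s) →
          suc d * (d * d ^ suc d) ≤ Total F
  lower H F octahedral split = begin
    suc d * (d * d ^ suc d)               ≡⟨ sym (∑-const (suc d) (d * d ^ suc d)) ⟩
    sum {suc d} (λ _ → d * d ^ suc d)     ≤⟨ ∑-mono-≤ colour-lower ⟩
    Total F                               ∎
    where
    open ≤-Reasoning
    octahedron-lower : ∀ i t → d * 𝟙 (avoids? t) ≤ 𝟙 (avoids? t) * weighted (inOctahedron F) i t
    octahedron-lower i t = by-avoidance (avoids? t)
      where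
      by-avoidance : (avoids?′ : Dec (∀ j → lookup e j ≢ lookup t j)) →
                     d * 𝟙 avoids?′ ≤ 𝟙 avoids?′ * weighted (inOctahedron F) i t
      by-avoidance (no _) = ≤-reflexive (*-zeroʳ d)
      by-avoidance (yes avoids) = subst₂ _≤_ (sym (*-identityʳ d)) (sym (*-identityˡ _))
        (parity-lower i (λ s → count H i s e t) (inOctahedron F i t) (split i t)
                      (λ s → octahedral i e t (λ j _ → avoids j) s (lookup e i)))
    colour-lower : ∀ i → d * d ^ suc d ≤ colourTotal (inOctahedron F) i
    colour-lower i = begin
      d * d ^ suc d                        ≡⟨ cong (d *_) (sym avoiding-count) ⟩
      d * ΣVec (λ t → 𝟙 (avoids? t))       ≡⟨ sym (ΣVec-*ˡ d (λ t → 𝟙 (avoids? t))) ⟩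
      ΣVec (λ t → d * 𝟙 (avoids? t))       ≤⟨ ΣVec-mono-≤ (octahedron-lower i) ⟩
      colourTotal (inOctahedron F) i       ∎

isolated⇒many-edges : ∀ {d} → 1 ≤ d → (H : Hypergraph d) → Octahedral H →
                      ∀ {e} → Isolated H e → d * d < length (edges H)
isolated⇒many-edges {d} d≥1 H octahedral {e} (e∈H , isolated) with ∈-∃++ e∈H
... | ys , zs , H≡ = begin-strict
  d * d             ≤⟨ *-cancelʳ-≤ (d * d) (length F) B {{B≢0}} (subst (_≤ length F * B) rearrange bounds) ⟩
  length F          <⟨ n<1+n (length F) ⟩
  suc (length F)    ≡⟨ sym (trans (cong length H≡) (length-++-sucʳ ys e zs)) ⟩
  length (edges H)  ∎
  where
  open ≤-Reasoning
  open Counting e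
  F : List (Edge d)
  F = ys ++ zs
  differ : All (DifferInTwo e) F
  differ = All.tabulate λ {f} f∈F →
    differ-in-two (All.lookup (others-distinct ys zs (subst Unique H≡ (unique H))) f∈F)
                  (λ one → isolated (f , subst (f ∈_) (sym H≡) (++⁺ʳ ys (xs⊆x∷xs zs e) f∈F) , one))
  split : ∀ i t s → count H i s e t ≡ 𝟙 (lookup e i ≟ s) + inOctahedron F i t s
  split i t s = trans (cong (length ∘ filter (supported? i s e t)) H≡)
    (trans (length-filter-insert (supported? i s e t) e ys zs)
           (cong (_+ inOctahedron F i t s) (self-supported i s t)))
  B : ℕ
  B = suc d * d ^ suc d
  B≢0 : NonZero B
  B≢0 = m*n≢0 (suc d) (d ^ suc d) {{_}} {{m^n≢0 d (suc d) {{>-nonZero d≥1}}}}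
  bounds : d * (suc d * (d * d ^ suc d)) ≤ length F * B
  bounds = ≤-trans (*-monoʳ-≤ d (lower H F octahedral split)) (upper F differ)
  rearrange : d * (suc d * (d * d ^ suc d)) ≡ (d * d) * B
  rearrange = solve 3 (λ a b c → a :* (b :* (a :* c)) := (a :* a) :* (b :* c)) refl d (suc d) (d ^ suc d)
    where open +-*-Solver

lemma2 : (d : ℕ) → 1 ≤ d → (H : Hypergraph d) → Octahedral H →
    length (edges H) ≤ d * d → ¬ (∃[ e ] Isolated H e)
lemma2 d d≥1 H octahedral few-edges (e , isolated) =
  <⇒≱ (isolated⇒many-edges d≥1 H octahedral isolated) few-edges
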